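{- Let $x\in V$, let $t\ge1$ be an integer and $0<\epsilon\le 1/2$, and let $\hat{\delta}_t(x)$ be a number with $\delta_t(x)\le\hat{\delta}_t(x)\le(1+\epsilon)\delta_t(x)$. If $t\ge n^2W/\epsilon$ and $\mu(x)\ge 1/n$, and $\hat{\mu}(x):=\hat{\delta}_t(x)/((1-\epsilon)t)$, then $\mu(x)\le\hat{\mu}(x)\le(1+7\epsilon)\mu(x)$.
   Context: $G=(V,E,w)$ is a directed graph with $n$ vertices, every vertex having at least one outgoing edge, and $w$ assigning a nonnegative integer weight to each edge; $W$ is the maximum edge weight. Paths may repeat edges; the length of a path is its number of edges and its weight is the sum of its edge weights; a cycle is a path whose start and end vertex coincide, and its mean weight is its weight divided by its length. $\mu(x)$ is the minimum mean weight of a cycle reachable from $x$, and $\delta_t(x)$ is the minimum weight of all paths of length exactly $t$ starting at $x$. -}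

module Defs where

open import Data.Nat using (ℕ; zero; suc; _+_; _≤_)
open import Data.Fin using (Fin)
open import Data.Integer using (+_)
open import Data.Rational using (ℚ; _/_) renaming (_≤_ to _≤ℚ_)
open import Data.Product using (Σ; ∃; _×_; _,_)

-- A weighted directed graph on vertex set Fin n.
-- E u v : there is an edge u → v ; w u v : its (nonnegative integer) weight
-- (the value of w on non-edges is irrelevant).
record Graph (n : ℕ) : Set₁ where
  field
    E : Fin n → Fin n → Set
    w : Fin n → Fin n → ℕ
    out : (u : Fin n) → ∃ λ v → E u v

module _ {n : ℕ} (G : Graph n) where
  open Graph G

  -- Paths (edges may repeat): Path u z k = path from u to z with exactly k edges.
  data Path : Fin n → Fin n → ℕ → Set where
    []   : ∀ {u} → Path u u 0
    step : ∀ {u v z k} → E u v → Path v z k → Path u z (suc k)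

  weight : ∀ {u z k} → Path u z k → ℕ
  weight []                     = 0
  weight (step {u} {v} e p)     = w u v + weight p

  IsMaxWeight : ℕ → Set
  IsMaxWeight W = (∃ λ u → ∃ λ v → E u v × w u v ≡′ W)
                × (∀ u v → E u v → w u v ≤ W)
    where open import Relation.Binary.PropositionalEquality renaming (_≡_ to _≡′_)

  mean : ∀ {v k} → Path v v (suc k) → ℚ
  mean {k = k} c = (+ weight c) / suc k

  IsMu : Fin n → ℚ → Set
  IsMu x m =
      (Σ (Fin n) λ v → Σ ℕ λ j → Path x v j × Σ ℕ λ k → Σ (Path v v (suc k)) λ c → mean c ≡′ m)
    × (∀ v j → Path x v j → ∀ k → (c : Path v v (suc k)) → m ≤ℚ mean c)
    where open import Relation.Binary.PropositionalEquality renaming (_≡_ to _≡′_)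

  IsDelta : ℕ → Fin n → ℕ → Set
  IsDelta t x d =
      (Σ (Fin n) λ z → Σ (Path x z t) λ p → weight p ≡′ d)
    × (∀ z → (p : Path x z t) → d ≤ weight p)
    where open import Relation.Binary.PropositionalEquality renaming (_≡_ to _≡′_)

-- The graph-theoretic content is a pair of bounds on δ = δ_t(x):
--   (lower)  μ·t ≤ δ + μ·n        and        (upper)  δ ≤ μ·t + n·W.
-- Both come from cutting walks into cycles.  A walk whose vertices are
-- pairwise distinct has fewer than n edges; any other walk contains a cycle
-- with at most n edges that can be cut out (`simple-or-cut`).  Cutting out
-- cycles one at a time, each weighing at least μ per edge, gives the lower
-- bound (`walk-lower-bound`).  For the upper bound, a reachable cycle of
-- mean at most μ can be shrunk to one with at most n edges
-- (`short-cheap-cycle`); walking to it along a simple path and winding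
-- around it yields a walk of length t and weight at most μ·t + n·W
-- (`cheap-walk`).  The rest is arithmetic in ℚ (`estimate`): the hypotheses
-- t·ε ≥ n²W and n·μ ≥ 1 make both error terms μ·n and n·W at most ε·μ·t, so
-- (1-ε)·μ·t ≤ δ̂ ≤ (1+ε)²·μ·t, and (1+ε)² ≤ (1+7ε)(1-ε) when ε ≤ ½.
module Submission where

open import Defs
open import Data.Nat using (ℕ; zero; suc; z≤n; s≤s)
  renaming (_≤_ to _≤ℕ_; _<_ to _<ℕ_; _+_ to _+ℕ_; _*_ to _*ℕ_; _≤?_ to _≤ℕ?_)
import Data.Nat.Properties as ℕₚ
open import Data.Nat.Induction using (<-wellFounded)
open import Induction.WellFounded using (Acc; acc)
open import Data.Fin as Fin using (Fin)
import Data.Fin.Properties as Finₚ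
open import Data.Integer using (+_)
import Data.Integer as ℤ
import Data.Integer.Properties as ℤₚ
open import Data.Rational
  using (ℚ; _/_; _+_; _-_; _*_; -_; _≤_; _<_; 0ℚ; 1ℚ; ½; toℚᵘ; Positive; nonNegative; positive)
open import Data.Rational.Properties
  using ( ≤-trans; ≤-reflexive; <⇒≤; <-≤-trans; <-irrefl; _≤?_; ≰⇒>
        ; +-mono-≤; +-monoˡ-≤; +-monoʳ-≤; +-monoˡ-<; +-monoʳ-<; +-identityˡ; +-identityʳ; +-inverseʳ
        ; *-comm; *-zeroʳ; *-distribˡ-+; *-monoˡ-≤-nonNeg; *-monoʳ-≤-nonNeg; *-cancelʳ-≤-pos
        ; nonNegative⁻¹; positive⁻¹; normalize-nonNeg; normalize-pos
        ; toℚᵘ-injective; toℚᵘ-fromℚᵘ; toℚᵘ-homo-+; toℚᵘ-homo-*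
        ; module ≤-Reasoning )
open import Data.Rational.Unnormalised using (mkℚᵘ; *≡*) renaming (_≃_ to _≃ᵘ_; _+_ to _+ᵘ_; _*_ to _*ᵘ_)
import Data.Rational.Unnormalised.Properties as ℚᵘₚ
open import Data.Rational.Solver using (module +-*-Solver)
open +-*-Solver using (solve; _:=_; _:+_; _:*_; _:-_; con)
open import Data.List using (List; []; _∷_; length; lookup)
open import Data.List.Membership.Propositional using (_∈_; _∉_)
open import Data.List.Membership.Propositional.Properties using (∈-lookup)
open import Data.List.Relation.Unary.Any using (here; there)
open import Data.Product using (Σ; _×_; _,_)
open import Data.Sum using (_⊎_; inj₁; inj₂)
open import Data.Empty using (⊥-elim)
open import Relation.Nullary using (yes; no)
open import Relation.Binary.PropositionalEquality
  using (_≡_; refl; sym; trans; cong; cong₂; subst; subst₂; module ≡-Reasoning)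


-- The embedding of ℕ into ℚ, written exactly as in the statement.
ι : ℕ → ℚ
ι a = + a / 1

-- As an unnormalised rational, ι a is the fraction a/1; this is how the
-- homomorphism properties of ι are transported from ℚᵘ.
ι-toℚᵘ : ∀ a → toℚᵘ (ι a) ≃ᵘ mkℚᵘ (+ a) 0
ι-toℚᵘ a = toℚᵘ-fromℚᵘ (mkℚᵘ (+ a) 0)

ι-+ : ∀ a b → ι (a +ℕ b) ≡ ι a + ι b
ι-+ a b = toℚᵘ-injective (begin
  toℚᵘ (ι (a +ℕ b))                ≈⟨ ι-toℚᵘ (a +ℕ b) ⟩
  mkℚᵘ (+ (a +ℕ b)) 0              ≈⟨ *≡* (cong (ℤ._* + 1) sum-of-fractions) ⟩
  mkℚᵘ (+ a) 0 +ᵘ mkℚᵘ (+ b) 0     ≈⟨ ℚᵘₚ.+-cong (ι-toℚᵘ a) (ι-toℚᵘ b) ⟨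
  toℚᵘ (ι a) +ᵘ toℚᵘ (ι b)         ≈⟨ toℚᵘ-homo-+ (ι a) (ι b) ⟨
  toℚᵘ (ι a + ι b)                 ∎)
  where
  open ℚᵘₚ.≃-Reasoning
  sum-of-fractions : + (a +ℕ b) ≡ + a ℤ.* + 1 ℤ.+ + b ℤ.* + 1
  sum-of-fractions = trans (ℤₚ.pos-+ a b) (sym (cong₂ ℤ._+_ (ℤₚ.*-identityʳ (+ a)) (ℤₚ.*-identityʳ (+ b))))

ι-* : ∀ a b → ι (a *ℕ b) ≡ ι a * ι b
ι-* a b = toℚᵘ-injective (begin
  toℚᵘ (ι (a *ℕ b))                ≈⟨ ι-toℚᵘ (a *ℕ b) ⟩
  mkℚᵘ (+ (a *ℕ b)) 0              ≈⟨ *≡* (cong (ℤ._* + 1) (ℤₚ.pos-* a b)) ⟩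
  mkℚᵘ (+ a) 0 *ᵘ mkℚᵘ (+ b) 0     ≈⟨ ℚᵘₚ.*-cong (ι-toℚᵘ a) (ι-toℚᵘ b) ⟨
  toℚᵘ (ι a) *ᵘ toℚᵘ (ι b)         ≈⟨ toℚᵘ-homo-* (ι a) (ι b) ⟨
  toℚᵘ (ι a * ι b)                 ∎)
  where open ℚᵘₚ.≃-Reasoning

ι-nonNeg : ∀ a → 0ℚ ≤ ι a
ι-nonNeg a = nonNegative⁻¹ (ι a) {{normalize-nonNeg a 1}}

ι-suc-positive : ∀ k → Positive (ι (suc k))
ι-suc-positive k = normalize-pos (suc k) 1

ι-mono : ∀ {a b} → a ≤ℕ b → ι a ≤ ι b
ι-mono {a} le with ℕₚ.m≤n⇒∃[o]m+o≡n le
... | d , refl = begin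
  ι a           ≡⟨ +-identityʳ (ι a) ⟨
  ι a + 0ℚ      ≤⟨ +-monoʳ-≤ (ι a) (ι-nonNeg d) ⟩
  ι a + ι d     ≡⟨ ι-+ a d ⟨
  ι (a +ℕ d)    ∎
  where open ≤-Reasoning

mean-*-length : ∀ w k → (+ w / suc k) * ι (suc k) ≡ ι w
mean-*-length w k = toℚᵘ-injective (begin
  toℚᵘ ((+ w / suc k) * ι (suc k))              ≈⟨ toℚᵘ-homo-* (+ w / suc k) (ι (suc k)) ⟩
  toℚᵘ (+ w / suc k) *ᵘ toℚᵘ (ι (suc k))        ≈⟨ ℚᵘₚ.*-cong (toℚᵘ-fromℚᵘ (mkℚᵘ (+ w) k)) (ι-toℚᵘ (suc k)) ⟩
  mkℚᵘ (+ w) k *ᵘ mkℚᵘ (+ suc k) 0              ≈⟨ *≡* cross-multiplied ⟩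
  mkℚᵘ (+ w) 0                                  ≈⟨ ι-toℚᵘ w ⟨
  toℚᵘ (ι w)                                    ∎)
  where
  open ℚᵘₚ.≃-Reasoning
  cross-multiplied : (+ w ℤ.* + suc k) ℤ.* + 1 ≡ + w ℤ.* + suc (k *ℕ 1)
  cross-multiplied = trans (ℤₚ.*-identityʳ _) (cong (λ m → + w ℤ.* + suc m) (sym (ℕₚ.*-identityʳ k)))

-- Inequalities between polynomial expressions
-- are proved by exhibiting the gap b - a as a visibly nonnegative
-- expression; the identity for the gap is checked by the ring solver.

gap-nonNeg : ∀ {a b} → a ≤ b → 0ℚ ≤ b - a
gap-nonNeg {a} {b} a≤b = subst (_≤ b - a) (+-inverseʳ a) (+-monoˡ-≤ (- a) a≤b)

≤-by-gap : ∀ {a b} g → 0ℚ ≤ g → b - a ≡ g → a ≤ b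
≤-by-gap {a} {b} g 0≤g gap = subst₂ _≤_ (+-identityˡ a) (cancel-gap a b) (+-monoˡ-≤ a 0≤b-a)
  where
  0≤b-a : 0ℚ ≤ b - a
  0≤b-a = subst (0ℚ ≤_) (sym gap) 0≤g
  cancel-gap : ∀ a b → (b - a) + a ≡ b
  cancel-gap = solve 2 (λ a b → (b :- a) :+ a := b) refl

0≤+ : ∀ {a b} → 0ℚ ≤ a → 0ℚ ≤ b → 0ℚ ≤ a + b
0≤+ = +-mono-≤

0≤* : ∀ {a b} → 0ℚ ≤ a → 0ℚ ≤ b → 0ℚ ≤ a * b
0≤* {a} {b} 0≤a 0≤b = subst (_≤ a * b) (*-zeroʳ a) (*-monoˡ-≤-nonNeg a {{nonNegative 0≤a}} 0≤b)

-- Used to recognise a cheap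
-- cycle after cutting an expensive one out of a cheap cycle.
cheap-remainder : ∀ {a b c d μ} → a + b ≤ μ * (c + d) → μ * d < b → a < μ * c
cheap-remainder {a} {b} {c} {d} {μ} total expensive =
  subst₂ _<_ (cancel-b a) (cancel-b (μ * c)) (+-monoˡ-< (- b) (begin-strict
    a + b              ≤⟨ total ⟩
    μ * (c + d)        ≡⟨ *-distribˡ-+ μ c d ⟩
    μ * c + μ * d      <⟨ +-monoʳ-< (μ * c) expensive ⟩
    μ * c + b          ∎))
  where
  open ≤-Reasoning
  cancel-b : ∀ x → (x + b) - b ≡ x
  cancel-b x = solve 2 (λ x b → (x :+ b) :- b := x) refl x b

data Distinct {A : Set} : List A → Set where
  []  : Distinct []
  _∷_ : ∀ {a l} → a ∉ l → Distinct l → Distinct (a ∷ l)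

distinct-lookup-injective : ∀ {A : Set} {l : List A} → Distinct l →
                            ∀ {i j} → lookup l i ≡ lookup l j → i ≡ j
distinct-lookup-injective (a∉l ∷ d) {Fin.zero}  {Fin.zero}  eq = refl
distinct-lookup-injective (a∉l ∷ d) {Fin.zero}  {Fin.suc j} eq = ⊥-elim (a∉l (subst (_∈ _) (sym eq) (∈-lookup j)))
distinct-lookup-injective (a∉l ∷ d) {Fin.suc i} {Fin.zero}  eq = ⊥-elim (a∉l (subst (_∈ _) eq (∈-lookup i)))
distinct-lookup-injective (a∉l ∷ d) {Fin.suc i} {Fin.suc j} eq = cong Fin.suc (distinct-lookup-injective d eq)

distinct-length : ∀ {m} {l : List (Fin m)} → Distinct l → length l ≤ℕ m
distinct-length {l = l} d = Finₚ.injective⇒≤ {f = lookup l} (distinct-lookup-injective d)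

module Walks {n : ℕ} (G : Graph n) where
  open Graph G
  open import Data.List.Membership.DecPropositional (Finₚ._≟_ {n}) using (_∈?_)

  infixr 5 _++_
  _++_ : ∀ {u v z i j} → Path G u v i → Path G v z j → Path G u z (i +ℕ j)
  []         ++ q = q
  step e p   ++ q = step e (p ++ q)

  weight-++ : ∀ {u v z i j} (p : Path G u v i) (q : Path G v z j) →
              weight G (p ++ q) ≡ weight G p +ℕ weight G q
  weight-++ []                 q = refl
  weight-++ (step {u} {v} e p) q = trans (cong (w u v +ℕ_) (weight-++ p q)) (sym (ℕₚ.+-assoc (w u v) _ _))

  repeat : ∀ m {a ℓ} → Path G a a ℓ → Path G a a (m *ℕ ℓ)
  repeat zero    c = []
  repeat (suc m) c = c ++ repeat m c

  weight-repeat : ∀ m {a ℓ} (c : Path G a a ℓ) → weight G (repeat m c) ≡ m *ℕ weight G c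
  weight-repeat zero    c = refl
  weight-repeat (suc m) c = trans (weight-++ c (repeat m c)) (cong (weight G c +ℕ_) (weight-repeat m c))

  prefix : ∀ t {u z k} → t ≤ℕ k → (p : Path G u z k) →
           Σ (Fin n) λ z′ → Σ (Path G u z′ t) λ q → weight G q ≤ℕ weight G p
  prefix zero    t≤k        p                  = _ , [] , z≤n
  prefix (suc t) (s≤s t≤k) (step {u} {v} e p) with prefix t t≤k p
  ... | z′ , q , q≤p = z′ , step e q , ℕₚ.+-monoʳ-≤ (w u v) q≤p

  weight-≤ : ∀ W → (∀ u v → E u v → w u v ≤ℕ W) → ∀ {u z k} (p : Path G u z k) → weight G p ≤ℕ k *ℕ W
  weight-≤ W maxW []                 = z≤n
  weight-≤ W maxW (step {u} {v} e p) = ℕₚ.+-mono-≤ (maxW u v e) (weight-≤ W maxW p)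

  vertices : ∀ {u z k} → Path G u z k → List (Fin n)
  vertices {u} []         = u ∷ []
  vertices {u} (step e p) = u ∷ vertices p

  length-vertices : ∀ {u z k} (p : Path G u z k) → length (vertices p) ≡ suc k
  length-vertices []         = refl
  length-vertices (step e p) = cong suc (length-vertices p)

  simple-short : ∀ {u z k} (p : Path G u z k) → Distinct (vertices p) → suc k ≤ℕ n
  simple-short p d = subst (_≤ℕ n) (length-vertices p) (distinct-length d)

  split-at : ∀ {u z k a} (p : Path G u z k) → a ∈ vertices p →
             Σ ℕ λ i → Σ ℕ λ j → Σ (Path G u a i) λ p₁ → Σ (Path G a z j) λ p₂ →
               (i +ℕ j ≡ k) × (weight G p₁ +ℕ weight G p₂ ≡ weight G p)
  split-at []                 (here refl) = 0 , 0 , [] , [] , refl , refl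
  split-at (step e p)         (here refl) = 0 , _ , [] , step e p , refl , refl
  split-at (step {u} {v} e p) (there a∈p) with split-at p a∈p
  ... | i , j , p₁ , p₂ , lengths , weights =
    suc i , j , step e p₁ , p₂ , cong suc lengths , trans (ℕₚ.+-assoc (w u v) _ _) (cong (w u v +ℕ_) weights)

  record CycleCut {u z k} (p : Path G u z k) : Set where
    field
      pivot        : Fin n
      i            : ℕ
      lead         : Path G u pivot i
      ℓ            : ℕ
      loop         : Path G pivot pivot (suc ℓ)
      loop-short   : suc ℓ ≤ℕ n
      k′           : ℕ
      rest         : Path G u z k′
      length-split : k ≡ k′ +ℕ suc ℓ
      weight-split : weight G p ≡ weight G rest +ℕ weight G loop

  simple-or-cut : ∀ {u z k} (p : Path G u z k) → Distinct (vertices p) ⊎ CycleCut p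
  simple-or-cut [] = inj₁ ((λ ()) ∷ [])
  simple-or-cut (step {u} {v} e p) with simple-or-cut p
  ... | inj₂ cut = inj₂ record
        { pivot = pivot ; i = suc i ; lead = step e lead ; ℓ = ℓ ; loop = loop ; loop-short = loop-short
        ; k′ = suc k′ ; rest = step e rest ; length-split = cong suc length-split
        ; weight-split = trans (cong (w u v +ℕ_) weight-split) (sym (ℕₚ.+-assoc (w u v) _ _)) }
    where open CycleCut cut
  ... | inj₁ simple with u ∈? vertices p
  ...   | no u∉p  = inj₁ (u∉p ∷ simple)
  ...   | yes u∈p with split-at p u∈p
  ...     | i , j , p₁ , p₂ , lengths , weights = inj₂ record
        { pivot = u ; i = 0 ; lead = [] ; ℓ = i ; loop = step e p₁
        ; loop-short = ℕₚ.≤-trans (s≤s (subst (i ≤ℕ_) lengths (ℕₚ.m≤m+n i j))) (simple-short p simple)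
        ; k′ = j ; rest = p₂
        ; length-split = trans (cong suc (trans (sym lengths) (ℕₚ.+-comm i j))) (sym (ℕₚ.+-suc j i))
        ; weight-split = trans (cong (w u v +ℕ_) (sym weights))
                               (trans (sym (ℕₚ.+-assoc (w u v) _ _)) (ℕₚ.+-comm _ (weight G p₂))) }

  rest-shorter : ∀ {u z k} {p : Path G u z k} (cut : CycleCut p) → CycleCut.k′ cut <ℕ k
  rest-shorter cut = subst (k′ <ℕ_) (sym length-split) (ℕₚ.m<m+n k′ (s≤s z≤n))
    where open CycleCut cut

  shortcut : ∀ {u z k} → Path G u z k → Σ ℕ λ j → Path G u z j × suc j ≤ℕ n
  shortcut {k = k} = go (<-wellFounded k)
    where
    go : ∀ {u z k} → Acc _<ℕ_ k → Path G u z k → Σ ℕ λ j → Path G u z j × suc j ≤ℕ n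
    go {k = k} (acc shorter) p with simple-or-cut p
    ... | inj₁ simple = k , p , simple-short p simple
    ... | inj₂ cut    = go (shorter (rest-shorter cut)) (CycleCut.rest cut)

ceiling-multiple : ∀ d ℓ → 0 <ℕ ℓ → Σ ℕ λ m → (d ≤ℕ m *ℕ ℓ) × (m *ℕ ℓ <ℕ d +ℕ ℓ)
ceiling-multiple zero    ℓ 0<ℓ = 0 , z≤n , 0<ℓ
ceiling-multiple (suc d) ℓ 0<ℓ with ceiling-multiple d ℓ 0<ℓ
... | m , d≤mℓ , mℓ<d+ℓ with suc d ≤ℕ? m *ℕ ℓ
...   | yes d<mℓ = m , d<mℓ , ℕₚ.m<n⇒m<1+n mℓ<d+ℓ
...   | no  d≮mℓ = suc m , next-above , next-below
  where
  mℓ≡d : m *ℕ ℓ ≡ d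
  mℓ≡d = ℕₚ.≤-antisym (ℕₚ.≤-pred (ℕₚ.≰⇒> d≮mℓ)) d≤mℓ
  next-above : suc d ≤ℕ ℓ +ℕ m *ℕ ℓ
  next-above = subst (λ x → suc d ≤ℕ ℓ +ℕ x) (sym mℓ≡d) (ℕₚ.+-monoˡ-≤ d 0<ℓ)
  next-below : ℓ +ℕ m *ℕ ℓ <ℕ suc d +ℕ ℓ
  next-below = subst (λ x → ℓ +ℕ x <ℕ suc d +ℕ ℓ) (sym mℓ≡d) (subst (_<ℕ suc d +ℕ ℓ) (ℕₚ.+-comm d ℓ) ℕₚ.≤-refl)

-- How often to wind around a cycle of length ℓ ≤ j + s + 1, after a walk of
-- length j, to cover at least t edges while overshooting by at most s.
winding-number : ∀ t j s ℓ → 0 <ℕ ℓ → ℓ ≤ℕ suc (j +ℕ s) →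
                 Σ ℕ λ m → (t ≤ℕ j +ℕ m *ℕ ℓ) × (m *ℕ ℓ ≤ℕ t +ℕ s)
winding-number t j s ℓ 0<ℓ ℓ≤1+j+s with ℕₚ.≤-total t j
... | inj₁ t≤j = 0 , ℕₚ.≤-trans t≤j (ℕₚ.≤-reflexive (sym (ℕₚ.+-identityʳ j))) , z≤n
... | inj₂ j≤t with ℕₚ.m≤n⇒∃[o]m+o≡n j≤t
...   | d , refl with ceiling-multiple d ℓ 0<ℓ
...     | m , d≤mℓ , mℓ<d+ℓ = m , ℕₚ.+-monoʳ-≤ j d≤mℓ , ℕₚ.≤-pred (ℕₚ.≤-trans mℓ<d+ℓ d+ℓ≤)
  where
  d+ℓ≤ : d +ℕ ℓ ≤ℕ suc (j +ℕ d +ℕ s)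
  d+ℓ≤ = ℕₚ.≤-trans (ℕₚ.+-monoʳ-≤ d ℓ≤1+j+s) (ℕₚ.≤-reflexive (begin
    d +ℕ suc (j +ℕ s)   ≡⟨ ℕₚ.+-suc d (j +ℕ s) ⟩
    suc (d +ℕ (j +ℕ s)) ≡⟨ cong suc (ℕₚ.+-assoc d j s) ⟨
    suc (d +ℕ j +ℕ s)   ≡⟨ cong (λ x → suc (x +ℕ s)) (ℕₚ.+-comm d j) ⟩
    suc (j +ℕ d +ℕ s)   ∎))
    where open ≡-Reasoning

winding-estimate : ∀ {μ T J S M W} → 0ℚ ≤ μ → μ ≤ W → 0ℚ ≤ S → 0ℚ ≤ W → M ≤ T + S →
                   J * W + μ * M ≤ μ * T + (1ℚ + (J + S)) * W
winding-estimate {μ} {T} {J} {S} {M} {W} μ≥0 μ≤W S≥0 W≥0 M≤T+S =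
  ≤-by-gap _ (0≤+ (0≤+ (0≤* μ≥0 (gap-nonNeg M≤T+S)) (0≤* S≥0 (gap-nonNeg μ≤W))) W≥0)
    (solve 6 (λ μ T J S M W → (μ :* T :+ (con 1ℚ :+ (J :+ S)) :* W) :- (J :* W :+ μ :* M)
                             := (μ :* ((T :+ S) :- M) :+ S :* (W :- μ)) :+ W) refl μ T J S M W)

module CycleMeans {n : ℕ} (G : Graph n) (x : Fin n) where
  open Graph G
  open Walks G

  MeanLowerBound : ℚ → Set
  MeanLowerBound μ = ∀ {v j k} → Path G x v j → (c : Path G v v (suc k)) → μ * ι (suc k) ≤ ι (weight G c)

  record CheapCycle (μ : ℚ) : Set where
    constructor cheapCycle
    field
      {base}  : Fin n
      {j L}   : ℕ
      reach   : Path G x base j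
      cycle   : Path G base base (suc L)
      cheap   : ι (weight G cycle) ≤ μ * ι (suc L)

  isMu⇒lower-bound : ∀ {μ} → IsMu G x μ → MeanLowerBound μ
  isMu⇒lower-bound {μ} (_ , minimal) {v} {j} {k} r c =
    subst (μ * ι (suc k) ≤_) (mean-*-length (weight G c) k)
      (*-monoʳ-≤-nonNeg (ι (suc k)) {{nonNegative (ι-nonNeg (suc k))}} (minimal v j r k c))

  isMu⇒cheap-cycle : ∀ {μ} → IsMu G x μ → CheapCycle μ
  isMu⇒cheap-cycle ((v , j , r , k , c , mean≡μ) , _) =
    cheapCycle r c (≤-reflexive (trans (sym (mean-*-length (weight G c) k)) (cong (_* ι (suc k)) mean≡μ)))

  isMu⇒nonNeg : ∀ {μ} → IsMu G x μ → 0ℚ ≤ μ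
  isMu⇒nonNeg ((v , j , r , k , c , mean≡μ) , _) =
    subst (0ℚ ≤_) mean≡μ (nonNegative⁻¹ _ {{normalize-nonNeg (weight G c) (suc k)}})

  -- Lower bound: a walk from a vertex reachable from x consists, up to
  -- fewer than n edges, of reachable cycles, each weighing ≥ μ per edge.
  walk-lower-bound : ∀ {μ} → 0ℚ ≤ μ → MeanLowerBound μ →
                     ∀ {u z j k} → Path G x u j → (p : Path G u z k) → μ * ι k ≤ ι (weight G p) + μ * ι n
  walk-lower-bound {μ} μ≥0 bound {k = k} = go (<-wellFounded k)
    where
    go : ∀ {u z j k} → Acc _<ℕ_ k → Path G x u j → (p : Path G u z k) → μ * ι k ≤ ι (weight G p) + μ * ι n
    go {k = k} (acc shorter) r p with simple-or-cut p
    ... | inj₁ simple = begin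
      μ * ι k                       ≤⟨ *-monoˡ-≤-nonNeg μ {{nonNegative μ≥0}} (ι-mono (ℕₚ.<⇒≤ (simple-short p simple))) ⟩
      μ * ι n                       ≡⟨ +-identityˡ (μ * ι n) ⟨
      0ℚ + μ * ι n                  ≤⟨ +-monoˡ-≤ (μ * ι n) (ι-nonNeg (weight G p)) ⟩
      ι (weight G p) + μ * ι n      ∎
      where open ≤-Reasoning
    ... | inj₂ cut = begin
      μ * ι k                                         ≡⟨ cong (λ m → μ * ι m) length-split ⟩
      μ * ι (k′ +ℕ suc ℓ)                             ≡⟨ cong (μ *_) (ι-+ k′ (suc ℓ)) ⟩
      μ * (ι k′ + ι (suc ℓ))                          ≡⟨ *-distribˡ-+ μ (ι k′) (ι (suc ℓ)) ⟩
      μ * ι k′ + μ * ι (suc ℓ)                        ≤⟨ +-mono-≤ (go (shorter (rest-shorter cut)) r rest) (bound (r ++ lead) loop) ⟩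
      (ι (weight G rest) + μ * ι n) + ι (weight G loop) ≡⟨ regroup (ι (weight G rest)) (ι (weight G loop)) (μ * ι n) ⟩
      (ι (weight G rest) + ι (weight G loop)) + μ * ι n ≡⟨ cong (_+ μ * ι n) (ι-+ (weight G rest) (weight G loop)) ⟨
      ι (weight G rest +ℕ weight G loop) + μ * ι n     ≡⟨ cong (λ y → ι y + μ * ι n) weight-split ⟨
      ι (weight G p) + μ * ι n                         ∎
      where
      open CycleCut cut
      open ≤-Reasoning
      regroup : ∀ a b e → (a + e) + b ≡ (a + b) + e
      regroup = solve 3 (λ a b e → (a :+ e) :+ b := (a :+ b) :+ e) refl

  ShortCheapCycle : ℚ → Set
  ShortCheapCycle μ = Σ (CheapCycle μ) λ C → suc (CheapCycle.L C) ≤ℕ n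

  -- A reachable cycle of mean ≤ μ can be replaced by one with at most n
  -- edges: if the cycle is not simple, cut out a short cycle; either that
  -- one is cheap, or the remaining (shorter) cycle is.
  short-cheap-cycle : ∀ {μ} → CheapCycle μ → ShortCheapCycle μ
  short-cheap-cycle {μ} (cheapCycle {L = L} r c cheap) = go (<-wellFounded L) r c cheap
    where
    go : ∀ {v j L} → Acc _<ℕ_ L → Path G x v j → (c : Path G v v (suc L)) →
         ι (weight G c) ≤ μ * ι (suc L) → ShortCheapCycle μ
    go {v} {L = L} (acc shorter) r c cheap with simple-or-cut c
    ... | inj₁ simple = cheapCycle r c cheap , ℕₚ.<⇒≤ (simple-short c simple)
    ... | inj₂ cut with ι (weight G (CycleCut.loop cut)) ≤? μ * ι (suc (CycleCut.ℓ cut))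
    ...   | yes loop-cheap = cheapCycle (r ++ CycleCut.lead cut) (CycleCut.loop cut) loop-cheap , CycleCut.loop-short cut
    ...   | no  loop-dear  = remaining (CycleCut.rest cut) (CycleCut.length-split cut) remainder-cheap
      where
      open CycleCut cut
      remainder-cheap : ι (weight G rest) < μ * ι k′
      remainder-cheap = cheap-remainder {d = ι (suc ℓ)} {μ = μ}
        (subst₂ (λ a b → a ≤ μ * b)
          (trans (cong ι weight-split) (ι-+ (weight G rest) (weight G loop)))
          (trans (cong ι length-split) (ι-+ k′ (suc ℓ))) cheap)
        (≰⇒> loop-dear)
      -- The remainder cannot be empty, as it would weigh less than 0.
      remaining : ∀ {k″} (remainder : Path G v v k″) → suc L ≡ k″ +ℕ suc ℓ →
                  ι (weight G remainder) < μ * ι k″ → ShortCheapCycle μ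
      remaining [] _ below-zero = ⊥-elim (<-irrefl (sym (*-zeroʳ μ)) below-zero)
      remaining {suc L′} remainder lengths remainder-cheap′ =
        go (shorter (subst (L′ <ℕ_) (sym (ℕₚ.suc-injective lengths)) (ℕₚ.m<m+n L′ (s≤s z≤n))))
           r remainder (<⇒≤ remainder-cheap′)

  module _ (W : ℕ) (maxW : ∀ u v → E u v → w u v ≤ℕ W) where

    lower-bound≤max-weight : ∀ {μ v j k} → MeanLowerBound μ → Path G x v j → Path G v v (suc k) → μ ≤ ι W
    lower-bound≤max-weight {μ} {k = k} bound r c = *-cancelʳ-≤-pos (ι (suc k)) {{ι-suc-positive k}} (begin
      μ * ι (suc k)       ≤⟨ bound r c ⟩
      ι (weight G c)      ≤⟨ ι-mono (weight-≤ W maxW c) ⟩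
      ι (suc k *ℕ W)      ≡⟨ ι-* (suc k) W ⟩
      ι (suc k) * ι W     ≡⟨ *-comm (ι (suc k)) (ι W) ⟩
      ι W * ι (suc k)     ∎)
      where open ≤-Reasoning

    -- Upper bound: walk from x along a simple path to a short cycle of mean
    -- ≤ μ and wind around it until t edges are covered.  This gives a walk
    -- of length t weighing at most μ·t + n·W.
    cheap-walk : ∀ {μ} → 0ℚ ≤ μ → μ ≤ ι W → (C : CheapCycle μ) → suc (CheapCycle.L C) ≤ℕ n →
                 ∀ t → Σ (Fin n) λ z → Σ (Path G x z t) λ q → ι (weight G q) ≤ μ * ι t + ι n * ι W
    cheap-walk {μ} μ≥0 μ≤W (cheapCycle {L = L} r c cheap) short t with shortcut r
    ... | j , P , j<n with ℕₚ.m≤n⇒∃[o]m+o≡n j<n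
    ... | s , n≡1+j+s with winding-number t j s (suc L) (s≤s z≤n) (subst (suc L ≤ℕ_) (sym n≡1+j+s) short)
    ... | m , covered , overshoot with prefix t covered (P ++ repeat m c)
    ... | z , q , q≤walk = z , q , (begin
      ι (weight G q)                                    ≤⟨ ι-mono q≤walk ⟩
      ι (weight G (P ++ repeat m c))                    ≡⟨ cong ι walk-weight ⟩
      ι (weight G P +ℕ m *ℕ weight G c)                 ≡⟨ ι-+ (weight G P) (m *ℕ weight G c) ⟩
      ι (weight G P) + ι (m *ℕ weight G c)              ≡⟨ cong (λ y → ι (weight G P) + y) (ι-* m (weight G c)) ⟩
      ι (weight G P) + ι m * ι (weight G c)             ≤⟨ +-mono-≤ lead-bound (*-monoˡ-≤-nonNeg (ι m) {{nonNegative (ι-nonNeg m)}} cheap) ⟩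
      ι j * ι W + ι m * (μ * ι (suc L))                 ≡⟨ cong (λ y → ι j * ι W + y) windings ⟩
      ι j * ι W + μ * ι (m *ℕ suc L)                    ≤⟨ winding-estimate {J = ι j} μ≥0 μ≤W (ι-nonNeg s) (ι-nonNeg W)
                                                             (subst (ι (m *ℕ suc L) ≤_) (ι-+ t s) (ι-mono overshoot)) ⟩
      μ * ι t + (1ℚ + (ι j + ι s)) * ι W                ≡⟨ cong (λ y → μ * ι t + y * ι W) vertex-count ⟩
      μ * ι t + ι n * ι W                               ∎)
      where
      open ≤-Reasoning
      walk-weight : weight G (P ++ repeat m c) ≡ weight G P +ℕ m *ℕ weight G c
      walk-weight = trans (weight-++ P (repeat m c)) (cong (weight G P +ℕ_) (weight-repeat m c))
      lead-bound : ι (weight G P) ≤ ι j * ι W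
      lead-bound = subst (ι (weight G P) ≤_) (ι-* j W) (ι-mono (weight-≤ W maxW P))
      windings : ι m * (μ * ι (suc L)) ≡ μ * ι (m *ℕ suc L)
      windings = trans (solve 3 (λ m μ ℓ → m :* (μ :* ℓ) := μ :* (m :* ℓ)) refl (ι m) μ (ι (suc L)))
                       (cong (μ *_) (sym (ι-* m (suc L))))
      vertex-count : 1ℚ + (ι j + ι s) ≡ ι n
      vertex-count = trans (cong (λ y → 1ℚ + y) (sym (ι-+ j s))) (trans (sym (ι-+ 1 (j +ℕ s))) (cong ι n≡1+j+s))

max-weight-positive : ∀ {μ N} W → 0ℚ ≤ N → μ ≤ ι W → 1ℚ ≤ N * μ → 1 ≤ℕ W
max-weight-positive (suc W) _ _ _ = s≤s z≤n
max-weight-positive {μ} {N} zero N≥0 μ≤0 1≤Nμ = ⊥-elim (<-irrefl refl (<-≤-trans (positive⁻¹ 1ℚ) (begin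
  1ℚ        ≤⟨ 1≤Nμ ⟩
  N * μ     ≤⟨ *-monoˡ-≤-nonNeg N {{nonNegative N≥0}} μ≤0 ⟩
  N * 0ℚ    ≡⟨ *-zeroʳ N ⟩
  0ℚ        ∎)))
  where open ≤-Reasoning

≤-square-* : ∀ m k → 1 ≤ℕ k → m ≤ℕ m *ℕ m *ℕ k
≤-square-* zero    k       _ = z≤n
≤-square-* (suc m) (suc k) _ =
  ℕₚ.≤-trans (ℕₚ.m≤m*n (suc m) (suc m)) (ℕₚ.m≤m*n (suc m *ℕ suc m) (suc k))

error-terms : ∀ {μ ε T N W} → 0ℚ ≤ μ → 0ℚ ≤ N → 0ℚ ≤ W → N ≤ N * N * W → N * N * W ≤ T * ε → 1ℚ ≤ N * μ →
              μ * N ≤ ε * (μ * T) × N * W ≤ ε * (μ * T)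
error-terms {μ} {ε} {T} {N} {W} μ≥0 N≥0 W≥0 N≤N²W N²W≤Tε 1≤Nμ =
  ≤-by-gap _ (0≤+ (0≤* μ≥0 (gap-nonNeg N²W≤Tε)) (0≤* μ≥0 (gap-nonNeg N≤N²W)))
    (solve 5 (λ μ ε T N W → ε :* (μ :* T) :- μ :* N
                           := μ :* (T :* ε :- N :* N :* W) :+ μ :* (N :* N :* W :- N)) refl μ ε T N W) ,
  ≤-by-gap _ (0≤+ (0≤* μ≥0 (gap-nonNeg N²W≤Tε)) (0≤* (0≤* N≥0 W≥0) (gap-nonNeg 1≤Nμ)))
    (solve 5 (λ μ ε T N W → ε :* (μ :* T) :- N :* W
                           := μ :* (T :* ε :- N :* N :* W) :+ (N :* W) :* (N :* μ :- con 1ℚ)) refl μ ε T N W)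

½≤[1-ε]T : ∀ {ε T} → ε ≤ ½ → 1ℚ ≤ T → ½ ≤ (1ℚ - ε) * T
½≤[1-ε]T {ε} {T} ε≤½ 1≤T =
  ≤-by-gap _ (0≤+ (0≤* (gap-nonNeg ε≤½) T≥0) (0≤* (nonNegative⁻¹ ½) (gap-nonNeg 1≤T)))
    (solve 2 (λ ε T → (con 1ℚ :- ε) :* T :- con ½ := (con ½ :- ε) :* T :+ con ½ :* (T :- con 1ℚ)) refl ε T)
  where
  T≥0 : 0ℚ ≤ T
  T≥0 = ≤-trans (nonNegative⁻¹ 1ℚ) 1≤T

-- Lower half of the estimate: δ̂ ≥ D ≥ μT - μN ≥ (1-ε)·μT.
δ̂-above : ∀ {μ ε T N D δ̂} → μ * T ≤ D + μ * N → μ * N ≤ ε * (μ * T) → D ≤ δ̂ →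
          μ * ((1ℚ - ε) * T) ≤ δ̂
δ̂-above {μ} {ε} {T} {N} {D} {δ̂} μT≤D+μN μN≤εμT D≤δ̂ =
  ≤-by-gap _ (0≤+ (0≤+ (gap-nonNeg D≤δ̂) (gap-nonNeg μT≤D+μN)) (gap-nonNeg μN≤εμT))
    (solve 6 (λ μ ε T N D δ̂ → δ̂ :- μ :* ((con 1ℚ :- ε) :* T)
                             := ((δ̂ :- D) :+ ((D :+ μ :* N) :- μ :* T)) :+ (ε :* (μ :* T) :- μ :* N))
      refl μ ε T N D δ̂)

-- Upper half of the estimate: δ̂ ≤ (1+ε)D ≤ (1+ε)(μT + NW) ≤ (1+ε)²·μT,
-- and (1+7ε)(1-ε) - (1+ε)² = 4ε(1-2ε) ≥ 0 for ε ≤ ½.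
δ̂-below : ∀ {μ ε T N W D δ̂} → 0ℚ ≤ μ → 0ℚ ≤ ε → ε ≤ ½ → 0ℚ ≤ T →
          D ≤ μ * T + N * W → N * W ≤ ε * (μ * T) → δ̂ ≤ (1ℚ + ε) * D →
          δ̂ ≤ ((1ℚ + (+ 7 / 1) * ε) * μ) * ((1ℚ - ε) * T)
δ̂-below {μ} {ε} {T} {N} {W} {D} {δ̂} μ≥0 ε≥0 ε≤½ T≥0 D≤μT+NW NW≤εμT δ̂≤[1+ε]D =
  ≤-by-gap _ (0≤+ (0≤+ (0≤+ (gap-nonNeg δ̂≤[1+ε]D) (0≤* 1+ε≥0 (gap-nonNeg D≤μT+NW)))
                        (0≤* 1+ε≥0 (gap-nonNeg NW≤εμT)))
                  (0≤* (0≤* (0≤* (0≤* (nonNegative⁻¹ (+ 8 / 1)) μ≥0) T≥0) ε≥0) (gap-nonNeg ε≤½)))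
    (solve 7 (λ μ ε T N W D δ̂ →
        (con 1ℚ :+ con (+ 7 / 1) :* ε) :* μ :* ((con 1ℚ :- ε) :* T) :- δ̂
          := ((((con 1ℚ :+ ε) :* D :- δ̂) :+ (con 1ℚ :+ ε) :* ((μ :* T :+ N :* W) :- D))
               :+ (con 1ℚ :+ ε) :* (ε :* (μ :* T) :- N :* W))
             :+ con (+ 8 / 1) :* μ :* T :* ε :* (con ½ :- ε))
      refl μ ε T N W D δ̂)
  where
  1+ε≥0 : 0ℚ ≤ 1ℚ + ε
  1+ε≥0 = 0≤+ (nonNegative⁻¹ 1ℚ) ε≥0

estimate : ∀ {μ ε T N W D δ̂ μ̂} → 0ℚ ≤ μ → 0ℚ < ε → ε ≤ ½ → 1ℚ ≤ T →
           μ * N ≤ ε * (μ * T) → N * W ≤ ε * (μ * T) →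
           μ * T ≤ D + μ * N → D ≤ μ * T + N * W →
           D ≤ δ̂ → δ̂ ≤ (1ℚ + ε) * D → μ̂ * ((1ℚ - ε) * T) ≡ δ̂ →
           μ ≤ μ̂ × μ̂ ≤ (1ℚ + (+ 7 / 1) * ε) * μ
estimate {μ} {ε} {T} {N} {W} μ≥0 0<ε ε≤½ 1≤T μN≤εμT NW≤εμT lower upper D≤δ̂ δ̂≤[1+ε]D μ̂-def =
  *-cancelʳ-≤-pos K {{K-positive}} (subst (μ * K ≤_) (sym μ̂-def) (δ̂-above {μ} {ε} {T} {N} lower μN≤εμT D≤δ̂)) ,
  *-cancelʳ-≤-pos K {{K-positive}} (subst (_≤ _) (sym μ̂-def)
    (δ̂-below {μ} {ε} {T} {N} {W} μ≥0 (<⇒≤ 0<ε) ε≤½ (≤-trans (nonNegative⁻¹ 1ℚ) 1≤T) upper NW≤εμT δ̂≤[1+ε]D))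
  where
  K : ℚ
  K = (1ℚ - ε) * T
  K-positive : Positive K
  K-positive = positive (<-≤-trans (positive⁻¹ ½) (½≤[1-ε]T ε≤½ 1≤T))

lemma4 : ∀ {n : ℕ} (G : Graph n) (W : ℕ) → IsMaxWeight G W →
         (x : Fin n) (t : ℕ) → 1 ≤ℕ t →
         (ε : ℚ) → 0ℚ < ε → ε ≤ ½ →
         (μ : ℚ) → IsMu G x μ →
         (δ : ℕ) → IsDelta G t x δ →
         (δ̂ : ℚ) → (+ δ / 1) ≤ δ̂ → δ̂ ≤ (1ℚ + ε) * (+ δ / 1) →
         -- t ≥ n²W/ε
         (+ (n *ℕ n *ℕ W) / 1) ≤ (+ t / 1) * ε →
         -- μ(x) ≥ 1/n
         1ℚ ≤ (+ n / 1) * μ →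
         -- with μ̂ := δ̂ / ((1-ε) t), i.e. μ̂ * ((1-ε) t) = δ̂ :
         (μ̂ : ℚ) → μ̂ * ((1ℚ - ε) * (+ t / 1)) ≡ δ̂ →
         μ ≤ μ̂ × μ̂ ≤ (1ℚ + (+ 7 / 1) * ε) * μ
lemma4 {n} G W (_ , maxW) x t 1≤t ε 0<ε ε≤½ μ isMu δ (δ-attained , δ-minimal) δ̂ δ≤δ̂ δ̂≤[1+ε]δ n²W≤tε 1≤nμ μ̂ μ̂-def =
  let (μn≤εμt , nW≤εμt) = error-bounds in
  estimate μ≥0 0<ε ε≤½ (ι-mono 1≤t) μn≤εμt nW≤εμt lower upper δ≤δ̂ δ̂≤[1+ε]δ μ̂-def
  where
  open CycleMeans G x
  μ≥0 : 0ℚ ≤ μ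
  μ≥0 = isMu⇒nonNeg isMu
  bound : MeanLowerBound μ
  bound = isMu⇒lower-bound isMu
  attained : CheapCycle μ
  attained = isMu⇒cheap-cycle isMu
  μ≤W : μ ≤ ι W
  μ≤W = lower-bound≤max-weight W maxW bound (CheapCycle.reach attained) (CheapCycle.cycle attained)
  lower : μ * ι t ≤ ι δ + μ * ι n
  lower = let (_ , p , p≡δ) = δ-attained in
    subst (λ d → μ * ι t ≤ ι d + μ * ι n) p≡δ (walk-lower-bound μ≥0 bound [] p)
  upper : ι δ ≤ μ * ι t + ι n * ι W
  upper = let (C , C-short) = short-cheap-cycle attained
              (z , q , q-bound) = cheap-walk W maxW μ≥0 μ≤W C C-short t
          in ≤-trans (ι-mono (δ-minimal z q)) q-bound
  -- both error terms are at most εμt, using n ≤ n²W (as W ≥ 1)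
  n²W≡ : ι (n *ℕ n *ℕ W) ≡ ι n * ι n * ι W
  n²W≡ = trans (ι-* (n *ℕ n) W) (cong (_* ι W) (ι-* n n))
  error-bounds : μ * ι n ≤ ε * (μ * ι t) × ι n * ι W ≤ ε * (μ * ι t)
  error-bounds = error-terms {T = ι t} μ≥0 (ι-nonNeg n) (ι-nonNeg W)
    (subst (ι n ≤_) n²W≡ (ι-mono (≤-square-* n W (max-weight-positive W (ι-nonNeg n) μ≤W 1≤nμ))))
    (subst (_≤ ι t * ε) n²W≡ n²W≤tε) 1≤nμ
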